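{- Let $\mathbf{D}\subseteq\mathbf{G}$ be totally ordered Abelian $\ell$-groups ($\mathbf D$ a subalgebra of $\mathbf G$) and assume $\mathbf{D}$ is divisible. Then for every EFD-sentence $\varphi$, $\mathbf{G}\models\varphi$ implies $\mathbf{D}\models\varphi$.
   Context: Abelian $\ell$-groups are algebras in $\{+,-,0,\vee,\wedge\}$ with $(A,+,-,0)$ an Abelian group, $(A,\vee,\wedge)$ a lattice, and $a+(b\vee c)=(a+b)\vee(a+c)$. An $\ell$-group is divisible if for every $g$ and positive integer $n$ there is $h$ with $nh=g$. An EFD-sentence is a sentence $\forall x_1\dots x_n\exists! z_1\dots z_m\bigwedge_{i=1}^k s_i(\bar x,\bar z)=t_i(\bar x,\bar z)$ with terms $s_i,t_i$, $n\ge0$, $m\ge1$. -}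

module Defs where

open import Level using (Level; _⊔_; suc)
open import Data.Nat using (ℕ; zero; _≤_) renaming (suc to sucℕ)
open import Data.Fin using (Fin)
open import Data.Sum using (_⊎_; inj₁; inj₂; [_,_])
open import Data.Product using (Σ; _×_; _,_)
open import Relation.Binary.PropositionalEquality using (_≡_)

record AbelianLGroup (a : Level) : Set (Level.suc a) where
  infixl 6 _+_
  infixr 7 _∨_ _∧_
  field
    Carrier : Set a
    _+_ : Carrier → Carrier → Carrier
    -_  : Carrier → Carrier
    0#  : Carrier
    _∨_ : Carrier → Carrier → Carrier
    _∧_ : Carrier → Carrier → Carrier
    +-assoc   : ∀ x y z → (x + y) + z ≡ x + (y + z)
    +-comm    : ∀ x y → x + y ≡ y + x
    +-identityˡ : ∀ x → 0# + x ≡ x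
    -‿inverseˡ  : ∀ x → (- x) + x ≡ 0#
    ∨-assoc : ∀ x y z → (x ∨ y) ∨ z ≡ x ∨ (y ∨ z)
    ∨-comm  : ∀ x y → x ∨ y ≡ y ∨ x
    ∧-assoc : ∀ x y z → (x ∧ y) ∧ z ≡ x ∧ (y ∧ z)
    ∧-comm  : ∀ x y → x ∧ y ≡ y ∧ x
    ∨-absorbs-∧ : ∀ x y → x ∨ (x ∧ y) ≡ x
    ∧-absorbs-∨ : ∀ x y → x ∧ (x ∨ y) ≡ x
    +-distrib-∨ : ∀ x y z → x + (y ∨ z) ≡ (x + y) ∨ (x + z)

  _≤ₗ_ : Carrier → Carrier → Set a
  x ≤ₗ y = x ∨ y ≡ y

  _·_ : ℕ → Carrier → Carrier
  zero · g = 0#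
  sucℕ n · g = g + (n · g)

open AbelianLGroup public using (Carrier)

TotallyOrdered : ∀ {a} → AbelianLGroup a → Set a
TotallyOrdered G = ∀ x y → (x ≤ₗ y) ⊎ (y ≤ₗ x)
  where open AbelianLGroup G

Divisible : ∀ {a} → AbelianLGroup a → Set a
Divisible G = ∀ (g : Carrier G) (n : ℕ) → 1 ≤ n → Σ (Carrier G) λ h → n · h ≡ g
  where open AbelianLGroup G

-- D is a subalgebra of G, up to isomorphism: an injective homomorphism
-- of {+,-,0,∨,∧}-algebras from D into G.
record Embedding {a b} (D : AbelianLGroup a) (G : AbelianLGroup b) : Set (a ⊔ b) where
  private
    module D = AbelianLGroup D
    module G = AbelianLGroup G
  field
    ⟦_⟧ : D.Carrier → G.Carrier
    injective : ∀ x y → ⟦ x ⟧ ≡ ⟦ y ⟧ → x ≡ y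
    hom-+ : ∀ x y → ⟦ x D.+ y ⟧ ≡ ⟦ x ⟧ G.+ ⟦ y ⟧
    hom-- : ∀ x → ⟦ D.- x ⟧ ≡ G.- ⟦ x ⟧
    hom-0 : ⟦ D.0# ⟧ ≡ G.0#
    hom-∨ : ∀ x y → ⟦ x D.∨ y ⟧ ≡ ⟦ x ⟧ G.∨ ⟦ y ⟧
    hom-∧ : ∀ x y → ⟦ x D.∧ y ⟧ ≡ ⟦ x ⟧ G.∧ ⟦ y ⟧

data Term (V : Set) : Set where
  var  : V → Term V
  _⊕_  : Term V → Term V → Term V
  ⊖_   : Term V → Term V
  zeroT : Term V
  _⊻_  : Term V → Term V → Term V
  _⊼_  : Term V → Term V → Term V

eval : ∀ {a} (A : AbelianLGroup a) {V : Set} → (V → Carrier A) → Term V → Carrier A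
eval A ρ (var v) = ρ v
eval A ρ (s ⊕ t) = AbelianLGroup._+_ A (eval A ρ s) (eval A ρ t)
eval A ρ (⊖ s) = AbelianLGroup.-_ A (eval A ρ s)
eval A ρ zeroT = AbelianLGroup.0# A
eval A ρ (s ⊻ t) = AbelianLGroup._∨_ A (eval A ρ s) (eval A ρ t)
eval A ρ (s ⊼ t) = AbelianLGroup._∧_ A (eval A ρ s) (eval A ρ t)

-- EFD-sentence: ∀ x₁…xₙ ∃! z₁…zₘ ⋀_{i<k} sᵢ(x̄,z̄) = tᵢ(x̄,z̄), with m ≥ 1.
-- Variables are Fin n (the x's, inj₁) ⊎ Fin m (the z's, inj₂).
record EFD : Set where
  field
    n m k : ℕ
    m≥1 : 1 ≤ m
    lhs rhs : Fin k → Term (Fin n ⊎ Fin m)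

Holds : ∀ {a} (A : AbelianLGroup a) (φ : EFD) →
        (Fin (EFD.n φ) → Carrier A) → (Fin (EFD.m φ) → Carrier A) → Set a
Holds A φ x z = ∀ i → eval A ρ (EFD.lhs φ i) ≡ eval A ρ (EFD.rhs φ i)
  where ρ = [ x , z ]

_⊨_ : ∀ {a} (A : AbelianLGroup a) (φ : EFD) → Set a
A ⊨ φ = ∀ (x : Fin (EFD.n φ) → Carrier A) →
          Σ (Fin (EFD.m φ) → Carrier A) λ z →
            Holds A φ x z ×
            (∀ z′ → Holds A φ x z′ → ∀ j → z′ j ≡ z j)

-- Fix parameters x̄ from D and the solution w̄ in G.  Since G is totally
-- ordered, near w̄ each term is a linear form Σⱼ aⱼ zⱼ + c (aⱼ ∈ ℤ, c ∈ D) on a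
-- region cut out by finitely many linear inequalities recording which argument
-- of each ∨, ∧ is larger (Linearization).  So the equations at w̄ become a
-- finite system 0 ≤ F of linear inequalities with constants in D, solvable in
-- G.  Fourier–Motzkin elimination makes it solvable in D: eliminating an
-- unknown is sound in any ℓ-group (Elimination), and a solution of the
-- eliminated system extends in D because D is divisible and totally ordered
-- (Completeness).  At the D-solution the equations hold again (Transfer); it is
-- unique because D-solutions are G-solutions and the embedding is injective.

module Submission where

open import Level using (Level)
open import Defs
open import Algebra.Bundles using (AbelianGroup; CommutativeMonoid)
import Algebra.Properties.AbelianGroup as AbelianGroupProperties
import Algebra.Properties.CommutativeSemigroup as CommutativeSemigroupProperties
import Algebra.Properties.CommutativeMonoid.Mult as MultProperties
import Algebra.Properties.CommutativeMonoid.Sum as SumProperties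
open import Data.Nat as ℕ using (ℕ; zero; suc; s≤s; z≤n; Ordering; less; equal; greater; compare)
import Data.Nat.Properties as ℕₚ
open import Data.Fin using (Fin; zero; suc)
open import Data.Vec.Functional using () renaming (_∷_ to _∷ᵛ_)
open import Data.Sum using (_⊎_; inj₁; inj₂; [_,_])
open import Data.Product using (Σ; _×_; _,_; proj₁; proj₂)
open import Data.List using (List; []; _∷_; _++_; foldr; map; concat; tabulate)
import Data.List.Relation.Unary.All.Properties as All
open import Data.List.Relation.Unary.All as All using (All; []; _∷_)
open import Relation.Binary.PropositionalEquality hiding ([_])

module LGroupFacts {a} (A : AbelianLGroup a) where
  open AbelianLGroup A hiding (Carrier)
  open ≡-Reasoning

  -- The group reduct of A as a library abelian group, so that the library's
  -- identities for groups, multiples and finite sums apply to A.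
  abelianGroup : AbelianGroup a a
  abelianGroup = record
    { Carrier = Carrier A
    ; _≈_ = _≡_
    ; _∙_ = _+_
    ; ε = 0#
    ; _⁻¹ = -_
    ; isAbelianGroup = record
      { isGroup = record
        { isMonoid = record
          { isSemigroup = record
            { isMagma = record { isEquivalence = isEquivalence ; ∙-cong = cong₂ _+_ }
            ; assoc = +-assoc
            }
          ; identity = +-identityˡ , λ x → trans (+-comm x 0#) (+-identityˡ x)
          }
        ; inverse = -‿inverseˡ , λ x → trans (+-comm x (- x)) (-‿inverseˡ x)
        ; ⁻¹-cong = cong -_
        }
      ; comm = +-comm
      }
    }

  commutativeMonoid : CommutativeMonoid a a
  commutativeMonoid = AbelianGroup.commutativeMonoid abelianGroup

  open AbelianGroup abelianGroup public
    using () renaming (identityʳ to +-identityʳ; inverseʳ to -‿inverseʳ)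
  open AbelianGroupProperties abelianGroup public
    using (//-rightDividesˡ; //-rightDividesʳ; \\-leftDividesˡ; xyx⁻¹≈y)
    renaming (⁻¹-involutive to -‿involutive; ε⁻¹≈ε to -0≡0; ⁻¹-∙-comm to -‿distrib⁻¹)
  open CommutativeSemigroupProperties (CommutativeMonoid.commutativeSemigroup commutativeMonoid) public
    using (interchange; x∙yz≈y∙xz)
  open MultProperties commutativeMonoid using (×-homo-+; ×-distrib-+; ×-assocˡ)
    renaming (_×_ to _×ₘ_)
  open SumProperties commutativeMonoid public using (sum; sum-cong-≗; ∑-distrib-+; sum-replicate-zero)

  sum-additive : (h : Carrier A → Carrier A) → h 0# ≡ 0# → (∀ x y → h (x + y) ≡ h x + h y) →
                 ∀ {n} (f : Fin n → Carrier A) → sum (λ j → h (f j)) ≡ h (sum f)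
  sum-additive h h0 h+ {zero} f = sym h0
  sum-additive h h0 h+ {suc n} f =
    trans (cong (h (f zero) +_) (sum-additive h h0 h+ (λ j → f (suc j)))) (sym (h+ _ _))

  ·≗× : ∀ n x → n · x ≡ n ×ₘ x
  ·≗× zero x = refl
  ·≗× (suc n) x = cong (x +_) (·≗× n x)

  ·-homo-+ : ∀ m n x → (m ℕ.+ n) · x ≡ m · x + n · x
  ·-homo-+ m n x rewrite ·≗× (m ℕ.+ n) x | ·≗× m x | ·≗× n x = ×-homo-+ x m n

  ·-distrib-+ : ∀ n x y → n · (x + y) ≡ n · x + n · y
  ·-distrib-+ n x y rewrite ·≗× n (x + y) | ·≗× n x | ·≗× n y = ×-distrib-+ x y n

  ·-assoc : ∀ m n x → m · (n · x) ≡ (m ℕ.* n) · x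
  ·-assoc m n x rewrite ·≗× n x | ·≗× m (n ×ₘ x) | ·≗× (m ℕ.* n) x = ×-assocˡ x m n

  ·-zero : ∀ n → n · 0# ≡ 0#
  ·-zero zero = refl
  ·-zero (suc n) = trans (+-identityˡ _) (·-zero n)

  ·-neg : ∀ n x → n · (- x) ≡ - (n · x)
  ·-neg zero x = sym -0≡0
  ·-neg (suc n) x = trans (cong (- x +_) (·-neg n x)) (-‿distrib⁻¹ x (n · x))

  ·-comm : ∀ m n x → m · (n · x) ≡ n · (m · x)
  ·-comm m n x = begin
    m · (n · x)      ≡⟨ ·-assoc m n x ⟩
    (m ℕ.* n) · x    ≡⟨ cong (_· x) (ℕₚ.*-comm m n) ⟩
    (n ℕ.* m) · x    ≡⟨ ·-assoc n m x ⟨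
    n · (m · x)      ∎

  ∨-idem : ∀ x → x ∨ x ≡ x
  ∨-idem x = trans (cong (x ∨_) (sym (∧-absorbs-∨ x x))) (∨-absorbs-∧ x (x ∨ x))

  ∧-idem : ∀ x → x ∧ x ≡ x
  ∧-idem x = trans (cong (x ∧_) (sym (∨-absorbs-∧ x x))) (∧-absorbs-∨ x (x ∧ x))

  ≤-reflexive : ∀ {x y} → x ≡ y → x ≤ₗ y
  ≤-reflexive {x} refl = ∨-idem x

  ≤-trans : ∀ {x y z} → x ≤ₗ y → y ≤ₗ z → x ≤ₗ z
  ≤-trans {x} {y} {z} x≤y y≤z = begin
    x ∨ z          ≡⟨ cong (x ∨_) y≤z ⟨
    x ∨ (y ∨ z)    ≡⟨ ∨-assoc x y z ⟨
    (x ∨ y) ∨ z    ≡⟨ cong (_∨ z) x≤y ⟩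
    y ∨ z          ≡⟨ y≤z ⟩
    z              ∎

  ≤-antisym : ∀ {x y} → x ≤ₗ y → y ≤ₗ x → x ≡ y
  ≤-antisym {x} {y} x≤y y≤x = trans (sym y≤x) (trans (∨-comm y x) x≤y)

  x≤x∨y : ∀ x y → x ≤ₗ (x ∨ y)
  x≤x∨y x y = trans (sym (∨-assoc x x y)) (cong (_∨ y) (∨-idem x))

  y≤x∨y : ∀ x y → y ≤ₗ (x ∨ y)
  y≤x∨y x y = subst (y ≤ₗ_) (∨-comm y x) (x≤x∨y y x)

  ∨-least : ∀ {x y z} → x ≤ₗ z → y ≤ₗ z → (x ∨ y) ≤ₗ z
  ∨-least {x} {y} {z} x≤z y≤z = trans (∨-assoc x y z) (trans (cong (x ∨_) y≤z) x≤z)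

  ≤⇒∧ : ∀ {x y} → x ≤ₗ y → x ∧ y ≡ x
  ≤⇒∧ {x} {y} x≤y = trans (cong (x ∧_) (sym x≤y)) (∧-absorbs-∨ x y)

  ∧⇒≤ : ∀ {x y} → x ∧ y ≡ x → x ≤ₗ y
  ∧⇒≤ {x} {y} e = begin
    x ∨ y          ≡⟨ ∨-comm x y ⟩
    y ∨ x          ≡⟨ cong (y ∨_) (trans (sym e) (∧-comm x y)) ⟩
    y ∨ (y ∧ x)    ≡⟨ ∨-absorbs-∧ y x ⟩
    y              ∎

  x∧y≤y : ∀ x y → (x ∧ y) ≤ₗ y
  x∧y≤y x y = ∧⇒≤ (trans (∧-assoc x y y) (cong (x ∧_) (∧-idem y)))

  x∧y≤x : ∀ x y → (x ∧ y) ≤ₗ x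
  x∧y≤x x y = subst (_≤ₗ x) (∧-comm y x) (x∧y≤y y x)

  ⋁ : Carrier A → List (Carrier A) → Carrier A
  ⋁ b = foldr _∨_ b

  ⋀ : Carrier A → List (Carrier A) → Carrier A
  ⋀ b = foldr _∧_ b

  ≤-⋁ : ∀ b xs → All (_≤ₗ ⋁ b xs) xs
  ≤-⋁ b [] = []
  ≤-⋁ b (x ∷ xs) = x≤x∨y x _ ∷ All.map (λ le → ≤-trans le (y≤x∨y x _)) (≤-⋁ b xs)

  ⋁-least : ∀ {b z} xs → All (_≤ₗ z) xs → b ≤ₗ z → ⋁ b xs ≤ₗ z
  ⋁-least [] [] b≤z = b≤z
  ⋁-least (x ∷ xs) (x≤z ∷ xs≤z) b≤z = ∨-least x≤z (⋁-least xs xs≤z b≤z)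

  ⋀-≤ : ∀ b xs → All (⋀ b xs ≤ₗ_) xs
  ⋀-≤ b [] = []
  ⋀-≤ b (x ∷ xs) = x∧y≤x x _ ∷ All.map (≤-trans (x∧y≤y x _)) (⋀-≤ b xs)

  +-monoʳ-≤ : ∀ z {x y} → x ≤ₗ y → (z + x) ≤ₗ (z + y)
  +-monoʳ-≤ z {x} {y} x≤y = trans (sym (+-distrib-∨ z x y)) (cong (z +_) x≤y)

  +-monoˡ-≤ : ∀ z {x y} → x ≤ₗ y → (x + z) ≤ₗ (y + z)
  +-monoˡ-≤ z {x} {y} x≤y = subst₂ _≤ₗ_ (+-comm z x) (+-comm z y) (+-monoʳ-≤ z x≤y)

  +-mono-≤ : ∀ {x y u v} → x ≤ₗ y → u ≤ₗ v → (x + u) ≤ₗ (y + v)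
  +-mono-≤ {y = y} {u} x≤y u≤v = ≤-trans (+-monoˡ-≤ u x≤y) (+-monoʳ-≤ y u≤v)

  +-cancelʳ-≤ : ∀ z {x y} → (x + z) ≤ₗ (y + z) → x ≤ₗ y
  +-cancelʳ-≤ z {x} {y} le =
    subst₂ _≤ₗ_ (//-rightDividesʳ z x) (//-rightDividesʳ z y) (+-monoˡ-≤ (- z) le)

  ≤⇒0≤- : ∀ {x y} → x ≤ₗ y → 0# ≤ₗ (y + - x)
  ≤⇒0≤- {x} {y} x≤y = subst (_≤ₗ (y + - x)) (-‿inverseʳ x) (+-monoˡ-≤ (- x) x≤y)

  0≤-⇒≤ : ∀ {x y} → 0# ≤ₗ (y + - x) → x ≤ₗ y
  0≤-⇒≤ {x} {y} 0≤y-x = subst₂ _≤ₗ_ (+-identityˡ x) (//-rightDividesˡ x y) (+-monoˡ-≤ x 0≤y-x)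

  0≤+ : ∀ {x y} → 0# ≤ₗ x → 0# ≤ₗ y → 0# ≤ₗ (x + y)
  0≤+ 0≤x 0≤y = subst (_≤ₗ _) (+-identityˡ 0#) (+-mono-≤ 0≤x 0≤y)

  ·-mono-≤ : ∀ n {x y} → x ≤ₗ y → (n · x) ≤ₗ (n · y)
  ·-mono-≤ zero x≤y = ∨-idem 0#
  ·-mono-≤ (suc n) x≤y = +-mono-≤ x≤y (·-mono-≤ n x≤y)

  0≤· : ∀ n {x} → 0# ≤ₗ x → 0# ≤ₗ (n · x)
  0≤· n {x} 0≤x = subst (_≤ₗ (n · x)) (·-zero n) (·-mono-≤ n 0≤x)

  ·-cancel-≤ : TotallyOrdered A → ∀ n {x y} → (suc n · x) ≤ₗ (suc n · y) → x ≤ₗ y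
  ·-cancel-≤ total n {x} {y} le with total x y
  ... | inj₁ x≤y = x≤y
  ... | inj₂ y≤x = +-cancelʳ-≤ (n · x) (≤-trans le (+-monoʳ-≤ y (·-mono-≤ n y≤x)))

-- The identity embedding; it lets the ambient-group lemmas below, stated for
-- an arbitrary embedding D → A, be applied inside D itself.
idEmbedding : ∀ {a} (D : AbelianLGroup a) → Embedding D D
idEmbedding D = record
  { ⟦_⟧ = λ x → x
  ; injective = λ _ _ e → e
  ; hom-+ = λ _ _ → refl
  ; hom-- = λ _ → refl
  ; hom-0 = refl
  ; hom-∨ = λ _ _ → refl
  ; hom-∧ = λ _ _ → refl
  }

module EmbeddingFacts {a b} {D : AbelianLGroup a} {A : AbelianLGroup b} (E : Embedding D A) where
  private
    module D = AbelianLGroup D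
    module A = AbelianLGroup A
  open Embedding E

  hom-· : ∀ n x → ⟦ n D.· x ⟧ ≡ n A.· ⟦ x ⟧
  hom-· zero x = hom-0
  hom-· (suc n) x = trans (hom-+ x (n D.· x)) (cong (⟦ x ⟧ A.+_) (hom-· n x))

  reflect-≤ : ∀ {x y} → ⟦ x ⟧ A.≤ₗ ⟦ y ⟧ → x D.≤ₗ y
  reflect-≤ {x} {y} le = injective _ _ (trans (hom-∨ x y) le)

  eval-hom : ∀ {V : Set} (ρ : V → Carrier D) (ρ′ : V → Carrier A) → (∀ v → ⟦ ρ v ⟧ ≡ ρ′ v) →
             ∀ t → ⟦ eval D ρ t ⟧ ≡ eval A ρ′ t
  eval-hom ρ ρ′ e (var v) = e v
  eval-hom ρ ρ′ e (s ⊕ t) = trans (hom-+ _ _) (cong₂ A._+_ (eval-hom ρ ρ′ e s) (eval-hom ρ ρ′ e t))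
  eval-hom ρ ρ′ e (⊖ s) = trans (hom-- _) (cong A.-_ (eval-hom ρ ρ′ e s))
  eval-hom ρ ρ′ e zeroT = hom-0
  eval-hom ρ ρ′ e (s ⊻ t) = trans (hom-∨ _ _) (cong₂ A._∨_ (eval-hom ρ ρ′ e s) (eval-hom ρ ρ′ e t))
  eval-hom ρ ρ′ e (s ⊼ t) = trans (hom-∧ _ _) (cong₂ A._∧_ (eval-hom ρ ρ′ e s) (eval-hom ρ ρ′ e t))

module LinearForms {a} (D : AbelianLGroup a) where
  private module D = AbelianLGroup D

  -- An integer coefficient p - q, represented by the pair (p , q).
  Coef : Set
  Coef = ℕ × ℕ

  _+ᶜ_ : Coef → Coef → Coef
  (p , q) +ᶜ (p′ , q′) = (p ℕ.+ p′ , q ℕ.+ q′)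

  -ᶜ_ : Coef → Coef
  -ᶜ (p , q) = (q , p)

  _*ᶜ_ : ℕ → Coef → Coef
  n *ᶜ (p , q) = (n ℕ.* p , n ℕ.* q)

  δ : ∀ {m} → Fin m → Fin m → Coef
  δ zero zero = (1 , 0)
  δ zero (suc _) = (0 , 0)
  δ (suc _) zero = (0 , 0)
  δ (suc j) (suc j′) = δ j j′

  record Form (m : ℕ) : Set a where
    constructor form
    field
      const : Carrier D
      coeff : Fin m → Coef
  open Form public

  constant : ∀ {m} → Carrier D → Form m
  constant c = form c (λ _ → (0 , 0))

  unknown : ∀ {m} → Fin m → Form m
  unknown j = form D.0# (δ j)

  infixl 6 _⊞_ _⊟_
  infixr 7 _⊙_

  _⊞_ : ∀ {m} → Form m → Form m → Form m
  F ⊞ H = form (const F D.+ const H) (λ j → coeff F j +ᶜ coeff H j)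

  _⊟_ : ∀ {m} → Form m → Form m → Form m
  F ⊟ H = form (const F D.+ D.- const H) (λ j → coeff F j +ᶜ (-ᶜ coeff H j))

  _⊙_ : ∀ {m} → ℕ → Form m → Form m
  n ⊙ F = form (n D.· const F) (λ j → n *ᶜ coeff F j)

  lead : ∀ {m} → Form (suc m) → Coef
  lead F = coeff F zero

  rest : ∀ {m} → Form (suc m) → Form m
  rest F = form (const F) (λ j → coeff F (suc j))

  module Evaluation {b} {A : AbelianLGroup b} (E : Embedding D A) where
    open AbelianLGroup A hiding (Carrier)
    open LGroupFacts A
    open Embedding E
    open EmbeddingFacts E
    open ≡-Reasoning

    infixr 8 _⊛_

    _⊛_ : Coef → Carrier A → Carrier A
    (p , q) ⊛ g = p · g + - (q · g)

    ⊛-zero : ∀ g → (0 , 0) ⊛ g ≡ 0#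
    ⊛-zero g = trans (+-identityˡ _) -0≡0

    ⊛-one : ∀ g → (1 , 0) ⊛ g ≡ g
    ⊛-one g = trans (cong₂ _+_ (+-identityʳ g) -0≡0) (+-identityʳ g)

    ⊛-+ : ∀ u v g → (u +ᶜ v) ⊛ g ≡ u ⊛ g + v ⊛ g
    ⊛-+ (p , q) (p′ , q′) g = begin
      (p ℕ.+ p′) · g + - ((q ℕ.+ q′) · g)       ≡⟨ cong₂ (λ s t → s + - t) (·-homo-+ p p′ g) (·-homo-+ q q′ g) ⟩
      (p · g + p′ · g) + - (q · g + q′ · g)     ≡⟨ cong ((p · g + p′ · g) +_) (-‿distrib⁻¹ _ _) ⟨
      (p · g + p′ · g) + (- (q · g) + - (q′ · g)) ≡⟨ interchange _ _ _ _ ⟩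
      (p · g + - (q · g)) + (p′ · g + - (q′ · g)) ∎

    ⊛-neg : ∀ u g → (-ᶜ u) ⊛ g ≡ - (u ⊛ g)
    ⊛-neg (p , q) g = begin
      q · g + - (p · g)         ≡⟨ +-comm _ _ ⟩
      - (p · g) + q · g         ≡⟨ cong (- (p · g) +_) (-‿involutive _) ⟨
      - (p · g) + - - (q · g)   ≡⟨ -‿distrib⁻¹ _ _ ⟩
      - (p · g + - (q · g))     ∎

    ⊛-* : ∀ n u g → (n *ᶜ u) ⊛ g ≡ n · (u ⊛ g)
    ⊛-* n (p , q) g = begin
      (n ℕ.* p) · g + - ((n ℕ.* q) · g)   ≡⟨ cong₂ (λ s t → s + - t) (·-assoc n p g) (·-assoc n q g) ⟨
      n · (p · g) + - (n · (q · g))       ≡⟨ cong (n · (p · g) +_) (·-neg n _) ⟨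
      n · (p · g) + n · (- (q · g))       ≡⟨ ·-distrib-+ n _ _ ⟨
      n · (p · g + - (q · g))             ∎

    ⟪_⟫ : ∀ {m} → Form m → (Fin m → Carrier A) → Carrier A
    ⟪ F ⟫ w = ⟦ const F ⟧ + sum (λ j → coeff F j ⊛ w j)

    NonNeg : ∀ {m} → (Fin m → Carrier A) → Form m → Set b
    NonNeg w F = 0# ≤ₗ ⟪ F ⟫ w

    sum-zero : ∀ {m} (w : Fin m → Carrier A) → sum (λ j → (0 , 0) ⊛ w j) ≡ 0#
    sum-zero {m} w = trans (sum-cong-≗ (λ j → ⊛-zero (w j))) (sum-replicate-zero m)

    ev-constant : ∀ {m} c (w : Fin m → Carrier A) → ⟪ constant c ⟫ w ≡ ⟦ c ⟧
    ev-constant c w = trans (cong (⟦ c ⟧ +_) (sum-zero w)) (+-identityʳ _)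

    sum-δ : ∀ {m} (j : Fin m) (w : Fin m → Carrier A) → sum (λ j′ → δ j j′ ⊛ w j′) ≡ w j
    sum-δ zero w = trans (cong₂ _+_ (⊛-one (w zero)) (sum-zero (λ j → w (suc j)))) (+-identityʳ _)
    sum-δ (suc j) w = trans (cong₂ _+_ (⊛-zero (w zero)) (sum-δ j (λ j′ → w (suc j′)))) (+-identityˡ _)

    ev-unknown : ∀ {m} (j : Fin m) w → ⟪ unknown j ⟫ w ≡ w j
    ev-unknown j w = trans (cong₂ _+_ hom-0 (sum-δ j w)) (+-identityˡ _)

    ev-⊞ : ∀ {m} (F H : Form m) w → ⟪ F ⊞ H ⟫ w ≡ ⟪ F ⟫ w + ⟪ H ⟫ w
    ev-⊞ F H w = begin
      ⟦ const F D.+ const H ⟧ + sum (λ j → (coeff F j +ᶜ coeff H j) ⊛ w j)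
        ≡⟨ cong₂ _+_ (hom-+ _ _) (trans (sum-cong-≗ (λ j → ⊛-+ (coeff F j) (coeff H j) (w j)))
                                         (∑-distrib-+ (λ j → coeff F j ⊛ w j) (λ j → coeff H j ⊛ w j))) ⟩
      (⟦ const F ⟧ + ⟦ const H ⟧) + (sum (λ j → coeff F j ⊛ w j) + sum (λ j → coeff H j ⊛ w j))
        ≡⟨ interchange _ _ _ _ ⟩
      ⟪ F ⟫ w + ⟪ H ⟫ w ∎

    ev-⊟ : ∀ {m} (F H : Form m) w → ⟪ F ⊟ H ⟫ w ≡ ⟪ F ⟫ w + - ⟪ H ⟫ w
    ev-⊟ F H w = begin
      ⟦ const F D.+ D.- const H ⟧ + sum (λ j → (coeff F j +ᶜ (-ᶜ coeff H j)) ⊛ w j)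
        ≡⟨ cong₂ _+_ (trans (hom-+ _ _) (cong (⟦ const F ⟧ +_) (hom-- _)))
                     (trans (sum-cong-≗ (λ j → trans (⊛-+ (coeff F j) _ (w j)) (cong (coeff F j ⊛ w j +_) (⊛-neg (coeff H j) (w j)))))
                            (∑-distrib-+ (λ j → coeff F j ⊛ w j) (λ j → - (coeff H j ⊛ w j)))) ⟩
      (⟦ const F ⟧ + - ⟦ const H ⟧) + (ΣF + sum (λ j → - (coeff H j ⊛ w j)))
        ≡⟨ cong (λ s → (⟦ const F ⟧ + - ⟦ const H ⟧) + (ΣF + s)) (sum-additive -_ -0≡0 (λ x y → sym (-‿distrib⁻¹ x y)) (λ j → coeff H j ⊛ w j)) ⟩
      (⟦ const F ⟧ + - ⟦ const H ⟧) + (ΣF + - ΣH)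
        ≡⟨ interchange _ _ _ _ ⟩
      (⟦ const F ⟧ + ΣF) + (- ⟦ const H ⟧ + - ΣH)
        ≡⟨ cong (⟪ F ⟫ w +_) (-‿distrib⁻¹ _ _) ⟩
      ⟪ F ⟫ w + - ⟪ H ⟫ w ∎
      where
        ΣF = sum (λ j → coeff F j ⊛ w j)
        ΣH = sum (λ j → coeff H j ⊛ w j)

    ev-⊙ : ∀ {m} n (F : Form m) w → ⟪ n ⊙ F ⟫ w ≡ n · ⟪ F ⟫ w
    ev-⊙ n F w = begin
      ⟦ n D.· const F ⟧ + sum (λ j → (n *ᶜ coeff F j) ⊛ w j)
        ≡⟨ cong₂ _+_ (hom-· n _) (trans (sum-cong-≗ (λ j → ⊛-* n (coeff F j) (w j)))
                                         (sum-additive (n ·_) (·-zero n) (·-distrib-+ n) (λ j → coeff F j ⊛ w j))) ⟩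
      n · ⟦ const F ⟧ + n · sum (λ j → coeff F j ⊛ w j)
        ≡⟨ ·-distrib-+ n _ _ ⟨
      n · ⟪ F ⟫ w ∎

    ev-lead : ∀ {m} (F : Form (suc m)) w → ⟪ F ⟫ w ≡ lead F ⊛ w zero + ⟪ rest F ⟫ (λ j → w (suc j))
    ev-lead F w = x∙yz≈y∙xz _ _ _

    NonNeg-⊟⇒≤ : ∀ {m} (F H : Form m) w → NonNeg w (F ⊟ H) → ⟪ H ⟫ w ≤ₗ ⟪ F ⟫ w
    NonNeg-⊟⇒≤ F H w 0≤F-H = 0≤-⇒≤ (subst (0# ≤ₗ_) (ev-⊟ F H w) 0≤F-H)

    ≤⇒NonNeg-⊟ : ∀ {m} (F H : Form m) w → ⟪ H ⟫ w ≤ₗ ⟪ F ⟫ w → NonNeg w (F ⊟ H)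
    ≤⇒NonNeg-⊟ F H w H≤F = subst (0# ≤ₗ_) (sym (ev-⊟ F H w)) (≤⇒0≤- H≤F)

module Elimination {a} (D : AbelianLGroup a) where
  open LinearForms D

  -- A bound (k , L) on g stands for the expression (k+1)·g + L resp. L - (k+1)·g.
  Bound : ℕ → Set a
  Bound m = ℕ × Form m

  -- How g occurs in an inequality 0 ≤ c·g + L, according to the sign of c.
  data Occurrence (m : ℕ) : Set a where
    absent : Form m → Occurrence m    -- c = 0       :  0 ≤ L
    lower  : Bound m → Occurrence m   -- c = k + 1   :  0 ≤ (k+1)·g + L
    upper  : Bound m → Occurrence m   -- c = -(k+1)  :  0 ≤ L - (k+1)·g

  classify : ∀ {m p q} → Ordering p q → Form m → Occurrence m
  classify (less _ k) L = upper (k , L)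
  classify (equal _) L = absent L
  classify (greater _ k) L = lower (k , L)

  occurrence : ∀ {m} → Form (suc m) → Occurrence m
  occurrence F = classify (compare (proj₁ (lead F)) (proj₂ (lead F))) (rest F)

  absents : ∀ {m} → List (Occurrence m) → List (Form m)
  absents [] = []
  absents (absent L ∷ os) = L ∷ absents os
  absents (lower _ ∷ os) = absents os
  absents (upper _ ∷ os) = absents os

  lowers : ∀ {m} → List (Occurrence m) → List (Bound m)
  lowers [] = []
  lowers (absent _ ∷ os) = lowers os
  lowers (lower p ∷ os) = p ∷ lowers os
  lowers (upper _ ∷ os) = lowers os

  uppers : ∀ {m} → List (Occurrence m) → List (Bound m)
  uppers [] = []
  uppers (absent _ ∷ os) = uppers os
  uppers (lower _ ∷ os) = uppers os
  uppers (upper q ∷ os) = q ∷ uppers os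

  -- From 0 ≤ (k+1)·g + P and 0 ≤ Q - (l+1)·g follows 0 ≤ (l+1)·P + (k+1)·Q,
  -- in which g no longer occurs.
  combine : ∀ {m} → Bound m → Bound m → Form m
  combine (k , P) (l , Q) = suc l ⊙ P ⊞ suc k ⊙ Q

  combinations : ∀ {m} → List (Bound m) → List (Bound m) → List (Form m)
  combinations ps qs = concat (map (λ q → map (λ p → combine p q) ps) qs)

  combinations⁺ : ∀ {ℓ} {m} {P : Form m → Set ℓ} ps qs →
                  All (λ q → All (λ p → P (combine p q)) ps) qs → All P (combinations ps qs)
  combinations⁺ ps qs h = All.concat⁺ (All.map⁺ (All.map (λ {q} → All.map⁺ {f = λ p → combine p q}) h))

  combinations⁻ : ∀ {ℓ} {m} {P : Form m → Set ℓ} ps qs →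
                  All P (combinations ps qs) → All (λ q → All (λ p → P (combine p q)) ps) qs
  combinations⁻ ps qs h =
    All.map (λ {q} → All.map⁻ {f = λ p → combine p q})
            (All.map⁻ {f = λ q → map (λ p → combine p q) ps} (All.concat⁻ h))

  eliminate : ∀ {m} → List (Form (suc m)) → List (Form m)
  eliminate cs = absents os ++ combinations (lowers os) (uppers os)
    where os = map occurrence cs

  module Semantics {b} {A : AbelianLGroup b} (E : Embedding D A) where
    open AbelianLGroup A hiding (Carrier)
    open LGroupFacts A
    open Evaluation E
    open ≡-Reasoning

    Lower : ∀ {m} → Carrier A → (Fin m → Carrier A) → Bound m → Set b
    Lower g w (k , P) = 0# ≤ₗ (suc k · g + ⟪ P ⟫ w)

    Upper : ∀ {m} → Carrier A → (Fin m → Carrier A) → Bound m → Set b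
    Upper g w (l , Q) = 0# ≤ₗ (- (suc l · g) + ⟪ Q ⟫ w)

    value : ∀ {m} → Occurrence m → Carrier A → (Fin m → Carrier A) → Carrier A
    value (absent L) g w = ⟪ L ⟫ w
    value (lower (k , P)) g w = suc k · g + ⟪ P ⟫ w
    value (upper (l , Q)) g w = - (suc l · g) + ⟪ Q ⟫ w

    Satisfied : ∀ {m} → Carrier A → (Fin m → Carrier A) → Occurrence m → Set b
    Satisfied g w o = 0# ≤ₗ value o g w

    classify-value : ∀ {m p q} (o : Ordering p q) (L : Form m) g w →
                     (p , q) ⊛ g + ⟪ L ⟫ w ≡ value (classify o L) g w
    classify-value (less p k) L g w = cong (_+ ⟪ L ⟫ w) (begin
      p · g + - (suc (p ℕ.+ k) · g)          ≡⟨ cong (λ n → p · g + - (n · g)) (ℕₚ.+-suc p k) ⟨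
      p · g + - ((p ℕ.+ suc k) · g)          ≡⟨ cong (λ x → p · g + - x) (·-homo-+ p (suc k) g) ⟩
      p · g + - (p · g + suc k · g)          ≡⟨ cong (p · g +_) (-‿distrib⁻¹ _ _) ⟨
      p · g + (- (p · g) + - (suc k · g))    ≡⟨ \\-leftDividesˡ _ _ ⟩
      - (suc k · g)                          ∎)
    classify-value (equal p) L g w = trans (cong (_+ ⟪ L ⟫ w) (-‿inverseʳ (p · g))) (+-identityˡ _)
    classify-value (greater q k) L g w = cong (_+ ⟪ L ⟫ w) (begin
      suc (q ℕ.+ k) · g + - (q · g)          ≡⟨ cong (λ n → n · g + - (q · g)) (ℕₚ.+-suc q k) ⟨
      (q ℕ.+ suc k) · g + - (q · g)          ≡⟨ cong (_+ - (q · g)) (·-homo-+ q (suc k) g) ⟩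
      q · g + suc k · g + - (q · g)          ≡⟨ xyx⁻¹≈y _ _ ⟩
      suc k · g                              ∎)

    occurrence-value : ∀ {m} (F : Form (suc m)) w →
                       ⟪ F ⟫ w ≡ value (occurrence F) (w zero) (λ j → w (suc j))
    occurrence-value F w = trans (ev-lead F w)
      (classify-value (compare (proj₁ (lead F)) (proj₂ (lead F))) (rest F) (w zero) (λ j → w (suc j)))

    partition : ∀ {m} {g} {w : Fin m → Carrier A} os → All (Satisfied g w) os →
                All (NonNeg w) (absents os) × All (Lower g w) (lowers os) × All (Upper g w) (uppers os)
    partition [] [] = [] , [] , []
    partition (absent _ ∷ os) (h ∷ hs) = let ha , hl , hu = partition os hs in h ∷ ha , hl , hu
    partition (lower _ ∷ os) (h ∷ hs) = let ha , hl , hu = partition os hs in ha , h ∷ hl , hu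
    partition (upper _ ∷ os) (h ∷ hs) = let ha , hl , hu = partition os hs in ha , hl , h ∷ hu

    unpartition : ∀ {m} {g} {w : Fin m → Carrier A} os →
                  All (NonNeg w) (absents os) → All (Lower g w) (lowers os) → All (Upper g w) (uppers os) →
                  All (Satisfied g w) os
    unpartition [] _ _ _ = []
    unpartition (absent _ ∷ os) (h ∷ ha) hl hu = h ∷ unpartition os ha hl hu
    unpartition (lower _ ∷ os) ha (h ∷ hl) hu = h ∷ unpartition os ha hl hu
    unpartition (upper _ ∷ os) ha hl (h ∷ hu) = h ∷ unpartition os ha hl hu

    cancel-g : ∀ k l g X Y → suc l · (suc k · g + X) + suc k · (- (suc l · g) + Y) ≡ suc l · X + suc k · Y
    cancel-g k l g X Y = begin
      suc l · (suc k · g + X) + suc k · (- (suc l · g) + Y)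
        ≡⟨ cong₂ _+_ (·-distrib-+ (suc l) _ _) (·-distrib-+ (suc k) _ _) ⟩
      (suc l · (suc k · g) + suc l · X) + (suc k · (- (suc l · g)) + suc k · Y)
        ≡⟨ interchange _ _ _ _ ⟩
      (suc l · (suc k · g) + suc k · (- (suc l · g))) + (suc l · X + suc k · Y)
        ≡⟨ cong (λ t → (suc l · (suc k · g) + t) + (suc l · X + suc k · Y))
                (trans (·-neg (suc k) _) (cong -_ (·-comm (suc k) (suc l) g))) ⟩
      (suc l · (suc k · g) + - (suc l · (suc k · g))) + (suc l · X + suc k · Y)
        ≡⟨ cong (_+ (suc l · X + suc k · Y)) (-‿inverseʳ _) ⟩
      0# + (suc l · X + suc k · Y)
        ≡⟨ +-identityˡ _ ⟩
      suc l · X + suc k · Y ∎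

    ev-combine : ∀ {m} (p q : Bound m) w →
                 ⟪ combine p q ⟫ w ≡ suc (proj₁ q) · ⟪ proj₂ p ⟫ w + suc (proj₁ p) · ⟪ proj₂ q ⟫ w
    ev-combine (k , P) (l , Q) w = trans (ev-⊞ (suc l ⊙ P) (suc k ⊙ Q) w) (cong₂ _+_ (ev-⊙ (suc l) P w) (ev-⊙ (suc k) Q w))

    combine-sound : ∀ {m} {g} {w : Fin m → Carrier A} p q → Lower g w p → Upper g w q → NonNeg w (combine p q)
    combine-sound {g = g} {w} (k , P) (l , Q) lo up =
      subst (0# ≤ₗ_) (trans (cancel-g k l g (⟪ P ⟫ w) (⟪ Q ⟫ w)) (sym (ev-combine (k , P) (l , Q) w)))
            (0≤+ (0≤· (suc l) lo) (0≤· (suc k) up))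

    eliminate-sound : ∀ {m} (cs : List (Form (suc m))) w → All (NonNeg w) cs →
                      All (NonNeg (λ j → w (suc j))) (eliminate cs)
    eliminate-sound cs w h =
      All.++⁺ ha (combinations⁺ (lowers os) (uppers os) (All.map (λ {q} up → All.map (λ {p} lo → combine-sound p q lo up) hl) hu))
      where
        os = map occurrence cs
        holds : All (Satisfied (w zero) (λ j → w (suc j))) os
        holds = All.map⁺ (All.map (λ {F} → subst (0# ≤ₗ_) (occurrence-value F w)) h)
        ha = proj₁ (partition os holds)
        hl = proj₁ (proj₂ (partition os holds))
        hu = proj₂ (proj₂ (partition os holds))

  -- Completeness in a divisible totally ordered D: a solution of the
  -- eliminated system extends to a solution of the original system, taking
  -- for g a value between all lower and all upper bounds.
  module Completeness (total : TotallyOrdered D) (divisible : Divisible D) where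
    open AbelianLGroup D hiding (Carrier)
    open LGroupFacts D
    open Evaluation (idEmbedding D)
    open Semantics (idEmbedding D)

    _/suc_ : Carrier D → ℕ → Carrier D
    x /suc k = proj₁ (divisible x (suc k) (s≤s z≤n))

    /suc-spec : ∀ x k → suc k · (x /suc k) ≡ x
    /suc-spec x k = proj₂ (divisible x (suc k) (s≤s z≤n))

    -- The values of g at which a lower resp. upper bound is tight.
    lowerEnd : ∀ {m} → (Fin m → Carrier D) → Bound m → Carrier D
    lowerEnd w (k , P) = (- ⟪ P ⟫ w) /suc k

    upperEnd : ∀ {m} → (Fin m → Carrier D) → Bound m → Carrier D
    upperEnd w (l , Q) = ⟪ Q ⟫ w /suc l

    lowerEnd-≤ : ∀ {m} {g} (w : Fin m → Carrier D) p → lowerEnd w p ≤ₗ g → Lower g w p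
    lowerEnd-≤ {g = g} w (k , P) le =
      subst (λ x → 0# ≤ₗ (suc k · g + x)) (-‿involutive _)
            (≤⇒0≤- (subst (_≤ₗ (suc k · g)) (/suc-spec _ k) (·-mono-≤ (suc k) le)))

    ≤-upperEnd : ∀ {m} {g} (w : Fin m → Carrier D) q → g ≤ₗ upperEnd w q → Upper g w q
    ≤-upperEnd {g = g} w (l , Q) le =
      subst (0# ≤ₗ_) (+-comm _ _) (≤⇒0≤- (subst ((suc l · g) ≤ₗ_) (/suc-spec _ l) (·-mono-≤ (suc l) le)))

    combine-complete : ∀ {m} (w : Fin m → Carrier D) p q → NonNeg w (combine p q) → lowerEnd w p ≤ₗ upperEnd w q
    combine-complete w (k , P) (l , Q) h =
      ·-cancel-≤ total k (·-cancel-≤ total l (0≤-⇒≤ (subst (0# ≤ₗ_) value≡ h)))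
      where
        open ≡-Reasoning
        u = lowerEnd w (k , P)
        v = upperEnd w (l , Q)
        value≡ : ⟪ combine (k , P) (l , Q) ⟫ w ≡ suc l · (suc k · v) + - (suc l · (suc k · u))
        value≡ = begin
          ⟪ combine (k , P) (l , Q) ⟫ w                          ≡⟨ ev-combine (k , P) (l , Q) w ⟩
          suc l · ⟪ P ⟫ w + suc k · ⟪ Q ⟫ w                       ≡⟨ cong₂ (λ x y → suc l · x + suc k · y)
                                                                          (sym (trans (cong -_ (/suc-spec _ k)) (-‿involutive _)))
                                                                          (sym (/suc-spec _ l)) ⟩
          suc l · (- (suc k · u)) + suc k · (suc l · v)           ≡⟨ cong₂ _+_ (·-neg (suc l) _) (·-comm (suc k) (suc l) v) ⟩
          - (suc l · (suc k · u)) + suc l · (suc k · v)           ≡⟨ +-comm _ _ ⟩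
          suc l · (suc k · v) + - (suc l · (suc k · u))           ∎

    between : ∀ {m} → (Fin m → Carrier D) → List (Bound m) → List (Bound m) → Carrier D
    between w ps qs = ⋁ (⋀ 0# (map (upperEnd w) qs)) (map (lowerEnd w) ps)

    between-lower : ∀ {m} (w : Fin m → Carrier D) ps qs → All (λ p → lowerEnd w p ≤ₗ between w ps qs) ps
    between-lower w ps qs = All.map⁻ (≤-⋁ _ (map (lowerEnd w) ps))

    between-upper : ∀ {m} (w : Fin m → Carrier D) ps qs →
                    All (λ q → All (λ p → lowerEnd w p ≤ₗ upperEnd w q) ps) qs →
                    All (λ q → between w ps qs ≤ₗ upperEnd w q) qs
    between-upper w ps qs h = All.zipWith (λ (below , meet≤) → ⋁-least (map (lowerEnd w) ps) (All.map⁺ below) meet≤)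
                                          (h , All.map⁻ (⋀-≤ 0# (map (upperEnd w) qs)))

    eliminate-complete : ∀ {m} (cs : List (Form (suc m))) (w : Fin m → Carrier D) →
                         All (NonNeg w) (eliminate cs) → Σ (Carrier D) λ g → All (NonNeg (g ∷ᵛ w)) cs
    eliminate-complete cs w h =
      g , All.map (λ {F} → subst (0# ≤ₗ_) (sym (occurrence-value F (g ∷ᵛ w)))) (All.map⁻ holds)
      where
        os = map occurrence cs
        ps = lowers os
        qs = uppers os
        g = between w ps qs
        combined : All (λ q → All (λ p → NonNeg w (combine p q)) ps) qs
        combined = combinations⁻ ps qs (All.++⁻ʳ (absents os) h)
        holds : All (Satisfied g w) os
        holds = unpartition os (All.++⁻ˡ (absents os) h)
                  (All.map (λ {p} → lowerEnd-≤ w p) (between-lower w ps qs))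
                  (All.map (λ {q} → ≤-upperEnd w q)
                     (between-upper w ps qs (All.map (λ {q} → All.map (λ {p} → combine-complete w p q)) combined)))

-- The unknowns are eliminated one at a time (soundness in
-- G), and the solution is then rebuilt in D (completeness in D).
module FourierMotzkin {a b} {D : AbelianLGroup a} {G : AbelianLGroup b}
       (totalD : TotallyOrdered D) (divisible : Divisible D) (E : Embedding D G) where
  private module G = AbelianLGroup G
  open Embedding E
  open EmbeddingFacts E
  open LinearForms D
  open Elimination D
  open Completeness totalD divisible
  open Evaluation (idEmbedding D) using (NonNeg)
  open Evaluation E using () renaming (NonNeg to NonNegᴳ)
  open Semantics E using () renaming (eliminate-sound to eliminate-soundᴳ)

  -- Without unknowns an inequality is 0 ≤ c for a constant c, which the
  -- embedding reflects.
  constant-reflect : ∀ (F : Form 0) w → NonNegᴳ w F → NonNeg (λ ()) F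
  constant-reflect F w h =
    reflect-≤ (subst₂ G._≤ₗ_ (sym hom-0) (sym (trans (hom-+ _ _) (cong (⟦ const F ⟧ G.+_) hom-0))) h)

  fourier-motzkin : ∀ m (cs : List (Form m)) (w : Fin m → Carrier G) →
                    All (NonNegᴳ w) cs → Σ (Fin m → Carrier D) λ w′ → All (NonNeg w′) cs
  fourier-motzkin zero cs w h = (λ ()) , All.map (λ {F} → constant-reflect F w) h
  fourier-motzkin (suc m) cs w h =
    let w′ , h′ = fourier-motzkin m (eliminate cs) (λ j → w (suc j)) (eliminate-soundᴳ cs w h)
        g , h″ = eliminate-complete cs w′ h′
    in g ∷ᵛ w′ , h″

-- On the region cut out by finitely many inequalities
-- (which argument of each ∨ and ∧ is the larger one) a term in parameters x
-- from D and unknowns z agrees with a linear form.  The region is chosen to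
-- contain a given point w of the totally ordered G.
module Linearization {a b} {D : AbelianLGroup a} {G : AbelianLGroup b}
       (totalG : TotallyOrdered G) (E : Embedding D G)
       {n m} (x : Fin n → Carrier D) (w : Fin m → Carrier G) where
  private
    module D = AbelianLGroup D
    module G = AbelianLGroup G
  open LinearForms D
  open Evaluation E using (≤⇒NonNeg-⊟) renaming (⟪_⟫ to ⟪_⟫ᴳ; NonNeg to NonNegᴳ)

  -- A linear linear, and side conditions 0 ≤ F under which a term equals it.
  record Piece : Set a where
    constructor piece
    field
      linear : Form m
      side : List (Form m)
  open Piece public

  sort : ∀ {ℓ} {P Q : Set ℓ} → P ⊎ Q → Form m → Form m → Form m × Form m
  sort (inj₁ _) L L′ = L , L′
  sort (inj₂ _) L L′ = L′ , L

  decide : (s t : Piece) → (⟪ linear s ⟫ᴳ w G.≤ₗ ⟪ linear t ⟫ᴳ w) ⊎ (⟪ linear t ⟫ᴳ w G.≤ₗ ⟪ linear s ⟫ᴳ w)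
  decide s t = totalG (⟪ linear s ⟫ᴳ w) (⟪ linear t ⟫ᴳ w)

  smaller larger : Piece → Piece → Form m
  smaller s t = proj₁ (sort (decide s t) (linear s) (linear t))
  larger s t = proj₂ (sort (decide s t) (linear s) (linear t))

  -- s ∨ t is the larger and s ∧ t the smaller of the two pieces, both under the
  -- side condition smaller ≤ larger together with the side conditions of s and t.
  branchSide : Piece → Piece → List (Form m)
  branchSide s t = (larger s t ⊟ smaller s t) ∷ side s ++ side t

  linearize : Term (Fin n ⊎ Fin m) → Piece
  linearize (var (inj₁ i)) = piece (constant (x i)) []
  linearize (var (inj₂ j)) = piece (unknown j) []
  linearize (s ⊕ t) = piece (linear (linearize s) ⊞ linear (linearize t)) (side (linearize s) ++ side (linearize t))
  linearize (⊖ s) = piece (constant D.0# ⊟ linear (linearize s)) (side (linearize s))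
  linearize zeroT = piece (constant D.0#) []
  linearize (s ⊻ t) = piece (larger (linearize s) (linearize t)) (branchSide (linearize s) (linearize t))
  linearize (s ⊼ t) = piece (smaller (linearize s) (linearize t)) (branchSide (linearize s) (linearize t))

  sort-ordered : ∀ L L′ (d : (⟪ L ⟫ᴳ w G.≤ₗ ⟪ L′ ⟫ᴳ w) ⊎ (⟪ L′ ⟫ᴳ w G.≤ₗ ⟪ L ⟫ᴳ w)) →
                 ⟪ proj₁ (sort d L L′) ⟫ᴳ w G.≤ₗ ⟪ proj₂ (sort d L L′) ⟫ᴳ w
  sort-ordered L L′ (inj₁ le) = le
  sort-ordered L L′ (inj₂ le) = le

  branchSide-sound : ∀ s t → All (NonNegᴳ w) (side s) → All (NonNegᴳ w) (side t) → All (NonNegᴳ w) (branchSide s t)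
  branchSide-sound s t hs ht =
    ≤⇒NonNeg-⊟ (larger s t) (smaller s t) w (sort-ordered (linear s) (linear t) (decide s t)) ∷ All.++⁺ hs ht

  side-sound : ∀ t → All (NonNegᴳ w) (side (linearize t))
  side-sound (var (inj₁ _)) = []
  side-sound (var (inj₂ _)) = []
  side-sound (s ⊕ t) = All.++⁺ (side-sound s) (side-sound t)
  side-sound (⊖ s) = side-sound s
  side-sound zeroT = []
  side-sound (s ⊻ t) = branchSide-sound (linearize s) (linearize t) (side-sound s) (side-sound t)
  side-sound (s ⊼ t) = branchSide-sound (linearize s) (linearize t) (side-sound s) (side-sound t)

  module Correctness {c} {A : AbelianLGroup c} (E′ : Embedding D A) where
    open AbelianLGroup A hiding (Carrier)
    open LGroupFacts A
    open Embedding E′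
    open Evaluation E′

    sort-∨ : ∀ {ℓ} {P Q : Set ℓ} (d : P ⊎ Q) L L′ (u : Fin m → Carrier A) →
             ⟪ proj₁ (sort d L L′) ⟫ u ≤ₗ ⟪ proj₂ (sort d L L′) ⟫ u → ⟪ L ⟫ u ∨ ⟪ L′ ⟫ u ≡ ⟪ proj₂ (sort d L L′) ⟫ u
    sort-∨ (inj₁ _) L L′ u le = le
    sort-∨ (inj₂ _) L L′ u le = trans (∨-comm _ _) le

    sort-∧ : ∀ {ℓ} {P Q : Set ℓ} (d : P ⊎ Q) L L′ (u : Fin m → Carrier A) →
             ⟪ proj₁ (sort d L L′) ⟫ u ≤ₗ ⟪ proj₂ (sort d L L′) ⟫ u → ⟪ L ⟫ u ∧ ⟪ L′ ⟫ u ≡ ⟪ proj₁ (sort d L L′) ⟫ u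
    sort-∧ (inj₁ _) L L′ u le = ≤⇒∧ le
    sort-∧ (inj₂ _) L L′ u le = trans (∧-comm _ _) (≤⇒∧ le)

    ev-negate : ∀ (F : Form m) u → ⟪ constant D.0# ⊟ F ⟫ u ≡ - ⟪ F ⟫ u
    ev-negate F u = trans (ev-⊟ (constant D.0#) F u)
                          (trans (cong (_+ - ⟪ F ⟫ u) (trans (ev-constant D.0# u) hom-0)) (+-identityˡ _))

    linearize-correct : ∀ t (u : Fin m → Carrier A) → All (NonNeg u) (side (linearize t)) →
                        eval A [ (λ i → ⟦ x i ⟧) , u ] t ≡ ⟪ linear (linearize t) ⟫ u
    linearize-correct (var (inj₁ i)) u h = sym (ev-constant (x i) u)
    linearize-correct (var (inj₂ j)) u h = sym (ev-unknown j u)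
    linearize-correct (s ⊕ t) u h =
      trans (cong₂ _+_ (linearize-correct s u (All.++⁻ˡ _ h)) (linearize-correct t u (All.++⁻ʳ _ h)))
            (sym (ev-⊞ (linear (linearize s)) (linear (linearize t)) u))
    linearize-correct (⊖ s) u h = trans (cong -_ (linearize-correct s u h)) (sym (ev-negate (linear (linearize s)) u))
    linearize-correct zeroT u h = sym (trans (ev-constant D.0# u) hom-0)
    linearize-correct (s ⊻ t) u (h₀ ∷ h) =
      trans (cong₂ _∨_ (linearize-correct s u (All.++⁻ˡ _ h)) (linearize-correct t u (All.++⁻ʳ _ h)))
            (sort-∨ (decide ls lt) (linear ls) (linear lt) u (NonNeg-⊟⇒≤ (larger ls lt) (smaller ls lt) u h₀))
      where ls = linearize s; lt = linearize t
    linearize-correct (s ⊼ t) u (h₀ ∷ h) =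
      trans (cong₂ _∧_ (linearize-correct s u (All.++⁻ˡ _ h)) (linearize-correct t u (All.++⁻ʳ _ h)))
            (sort-∧ (decide ls lt) (linear ls) (linear lt) u (NonNeg-⊟⇒≤ (larger ls lt) (smaller ls lt) u h₀))
      where ls = linearize s; lt = linearize t

-- For parameters x from D,
-- linearizing both sides of every equation of φ along the solution w in G
-- gives a finite system of linear inequalities with constants in D that holds
-- at w; by Fourier–Motzkin it has a solution in D, at which the equations
-- hold again.
module Transfer {a b} {D : AbelianLGroup a} {G : AbelianLGroup b}
       (totalD : TotallyOrdered D) (totalG : TotallyOrdered G) (divisible : Divisible D)
       (E : Embedding D G) (φ : EFD) where
  open EFD φ
  open Embedding E
  open EmbeddingFacts E
  open LinearForms D
  open FourierMotzkin totalD divisible E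

  module _ (x : Fin n → Carrier D) (w : Fin m → Carrier G) where
    open Linearization totalG E x w

    -- Equation i as inequalities: lhs = rhs as two opposite inequalities, and the
    -- side conditions of both sides.
    equationSystem : Fin k → List (Form m)
    equationSystem i = (linear L ⊟ linear R) ∷ (linear R ⊟ linear L) ∷ side L ++ side R
      where
        L = linearize (lhs i)
        R = linearize (rhs i)

    system : List (Form m)
    system = concat (tabulate equationSystem)

    equation-sound : ∀ i → eval G [ (λ j → ⟦ x j ⟧) , w ] (lhs i) ≡ eval G [ (λ j → ⟦ x j ⟧) , w ] (rhs i) →
                     All (Evaluation.NonNeg E w) (equationSystem i)
    equation-sound i e =
      ≤⇒NonNeg-⊟ (linear L) (linear R) w (≤-reflexive (sym L≡R)) ∷
      ≤⇒NonNeg-⊟ (linear R) (linear L) w (≤-reflexive L≡R) ∷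
      All.++⁺ (side-sound (lhs i)) (side-sound (rhs i))
      where
        open LGroupFacts G using (≤-reflexive)
        open Evaluation E
        open Correctness E
        L = linearize (lhs i)
        R = linearize (rhs i)
        L≡R : ⟪ linear L ⟫ w ≡ ⟪ linear R ⟫ w
        L≡R = trans (sym (linearize-correct (lhs i) w (side-sound (lhs i))))
                    (trans e (linearize-correct (rhs i) w (side-sound (rhs i))))

    equation-complete : ∀ {c} {A : AbelianLGroup c} (E′ : Embedding D A) u i →
                        All (Evaluation.NonNeg E′ u) (equationSystem i) →
                        eval A [ (λ j → Embedding.⟦ E′ ⟧ (x j)) , u ] (lhs i) ≡ eval A [ (λ j → Embedding.⟦ E′ ⟧ (x j)) , u ] (rhs i)
    equation-complete {A = A} E′ u i (hL≥R ∷ hR≥L ∷ h) =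
      let hL , hR = All.++⁻ (side L) h
      in trans (linearize-correct (lhs i) u hL)
           (trans (≤-antisym (NonNeg-⊟⇒≤ (linear R) (linear L) u hR≥L) (NonNeg-⊟⇒≤ (linear L) (linear R) u hL≥R))
                  (sym (linearize-correct (rhs i) u hR)))
      where
        open LGroupFacts A using (≤-antisym)
        open Evaluation E′
        open Correctness E′
        L = linearize (lhs i)
        R = linearize (rhs i)

  solve-in-D : ∀ x w → Holds G φ (λ j → ⟦ x j ⟧) w → Σ (Fin m → Carrier D) (Holds D φ x)
  solve-in-D x w h =
    let w′ , h′ = fourier-motzkin m (system x w) w (All.concat⁺ (All.tabulate⁺ (λ i → equation-sound x w i (h i))))
    in w′ , λ i → equation-complete x w (idEmbedding D) w′ i (All.tabulate⁻ (All.concat⁻ h′) i)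

  holds-in-G : ∀ x z → Holds D φ x z → Holds G φ (λ j → ⟦ x j ⟧) (λ j → ⟦ z j ⟧)
  holds-in-G x z h i =
    trans (sym (eval-hom [ x , z ] ρ agree (lhs i))) (trans (cong ⟦_⟧ (h i)) (eval-hom [ x , z ] ρ agree (rhs i)))
    where
      ρ = [ (λ j → ⟦ x j ⟧) , (λ j → ⟦ z j ⟧) ]
      agree : ∀ v → ⟦ [ x , z ] v ⟧ ≡ ρ v
      agree (inj₁ _) = refl
      agree (inj₂ _) = refl

-- The solution in D comes from Fourier–Motzkin
-- (solve-in-D); it is unique because any two solutions in D map to solutions in
-- G, which coincide, and the embedding is injective.
corollary4p5 : ∀ {a b : Level} (D : AbelianLGroup a) (G : AbelianLGroup b) →
    TotallyOrdered D → TotallyOrdered G → Embedding D G → Divisible D →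
    (φ : EFD) → G ⊨ φ → D ⊨ φ
corollary4p5 D G totalD totalG E divisible φ G⊨φ x =
  let w , holdsG , uniqueG = G⊨φ (λ j → ⟦ x j ⟧)
      w′ , holdsD = solve-in-D x w holdsG
      same : ∀ z → Holds D φ x z → ∀ j → ⟦ z j ⟧ ≡ w j
      same z hz = uniqueG (λ j → ⟦ z j ⟧) (holds-in-G x z hz)
  in w′ , holdsD , λ z hz j → injective _ _ (trans (same z hz j) (sym (same w′ holdsD j)))
  where
    open Embedding E
    open Transfer totalD totalG divisible E φ
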